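{- For all integers $n\ge 2$ and $b\ge 1$, the circulant graph $G_{nb,b}$ satisfies $\mathrm{box}(G_{nb,b})\le\chi(G_{nb,b})$.
   Context: For integers $a\ge 2b\ge 2$, the graph $G_{a,b}$ has vertex set $\{0,1,\dots,a-1\}$, and distinct vertices $u,v$ are adjacent if and only if $u\in\{v+b,v+b+1,\dots,v+a-b\}$, with addition modulo $a$. A box in Euclidean $k$-space is a Cartesian product of $k$ closed intervals of the real line. The boxicity $\mathrm{box}(G)$ of a graph $G$ is the minimum nonnegative integer $k$ such that $G$ is isomorphic to the intersection graph of a family of boxes in Euclidean $k$-space. $\chi(G)$ is the chromatic number of $G$. -}

module Defs where

open import Data.Nat using (ℕ; _+_; _*_; _∸_; _≤_)
open import Data.Fin using (Fin; toℕ)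
open import Data.Rational using (ℚ) renaming (_≤_ to _≤ℚ_)
open import Data.Product using (Σ; ∃; _×_)
open import Relation.Binary.PropositionalEquality using (_≡_; _≢_)

Graph : ℕ → Set₁
Graph m = Fin m → Fin m → Set

-- The circulant graph G_{a,b} on {0,…,a-1}: distinct u, v adjacent iff
-- u ≡ v + j (mod a) for some j with b ≤ j ≤ a - b.
-- "u ≡ v + j (mod a)" with 0 ≤ u < a is written as v + j = u + q·a for some q.
G : (a b : ℕ) → Graph a
G a b u v = u ≢ v × ∃ λ j → b ≤ j × j ≤ a ∸ b × ∃ λ q → toℕ v + j ≡ toℕ u + q * a

record Box (k : ℕ) : Set where
  field
    lo hi : Fin k → ℚ
    lo≤hi : ∀ i → lo i ≤ℚ hi i
open Box public

Intersect : ∀ {k} → Box k → Box k → Set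
Intersect B C = ∀ i → (lo B i ≤ℚ hi C i) × (lo C i ≤ℚ hi B i)

BoxRepresentation : ∀ {m} → Graph m → ℕ → Set
BoxRepresentation {m} Gr k =
  Σ (Fin m → Box k) λ box →
    ∀ u v → u ≢ v → (Gr u v → Intersect (box u) (box v)) × (Intersect (box u) (box v) → Gr u v)

BoxicityAtMost : ∀ {m} → Graph m → ℕ → Set
BoxicityAtMost Gr k = ∃ λ k' → k' ≤ k × BoxRepresentation Gr k'

ProperColouring : ∀ {m} → Graph m → ℕ → Set
ProperColouring {m} Gr c = Σ (Fin m → Fin c) λ f → ∀ u v → Gr u v → f u ≢ f v

IsChromaticNumber : ∀ {m} → Graph m → ℕ → Set
IsChromaticNumber Gr c = ProperColouring Gr c × (∀ c' → ProperColouring Gr c' → c ≤ c')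

{-# OPTIONS --safe #-}
module Submission where

-- Write a vertex of G_{nb,b} as b·s + p with block s < n and offset p < b. Two distinct
-- vertices are non-adjacent exactly when they lie in the same block, or in cyclically
-- consecutive blocks s and s + 1 with the vertex of block s + 1 having the smaller offset.
-- Coordinate m of the box representation accounts for the non-edges at block m: it sends
-- block m to the points p, block m + 1 to the segments [0, p] and all other blocks to [0, b].
-- Hence box(G) ≤ n, while the vertices b·s, one per block, form a clique, so χ(G) ≥ n.

open import Defs
open import Data.Nat using (ℕ; _*_; _≤_; zero; suc; _+_; _<_; _∸_; z≤n; s≤s; _≟_; NonZero; >-nonZero⁻¹)
open import Data.Nat.Properties
open import Data.Nat.Tactic.RingSolver using (solve-∀)
open import Algebra.Properties.CommutativeSemigroup +-commutativeSemigroup using (xy∙z≈xz∙y)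
open import Data.Fin as Fin using (Fin; toℕ; combine; quotient; remainder)
open import Data.Fin.Properties as Finₚ using (toℕ<n; toℕ-injective; toℕ-combine; combine-remQuot; remQuot-combine; pigeonhole)
open import Data.Integer as ℤ using (+≤+)
import Data.Integer.Properties as ℤ
open import Data.Rational as ℚ using (ℚ; *≤*)
open import Data.Rational.Literals using (fromℤ)
open import Data.Product
open import Data.Product.Relation.Binary.Lex.Strict using (×-Lex)
open import Data.Sum using (_⊎_; inj₁; inj₂)
open import Data.Empty using (⊥-elim)
open import Function.Base using (_∘_)
open import Function.Bundles using (_⇔_; mk⇔; module Equivalence)
open import Function.Construct.Composition using (_⇔-∘_)
open import Function.Construct.Symmetry using (⇔-sym)
open import Relation.Nullary using (¬_; yes; no; _⊎-dec_)
open import Relation.Binary.PropositionalEquality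
open import Relation.Binary.Definitions using (tri<; tri≈; tri>)

open Equivalence using (to; from)

ℕ→ℚ : ℕ → ℚ
ℕ→ℚ m = fromℤ (ℤ.+ m)

ℕ→ℚ-mono-≤ : ∀ {m k} → m ≤ k → ℕ→ℚ m ℚ.≤ ℕ→ℚ k
ℕ→ℚ-mono-≤ {m} {k} m≤k =
  *≤* (subst₂ ℤ._≤_ (sym (ℤ.*-identityʳ (ℤ.+ m))) (sym (ℤ.*-identityʳ (ℤ.+ k))) (+≤+ m≤k))

ℕ→ℚ-cancel-≤ : ∀ {m k} → ℕ→ℚ m ℚ.≤ ℕ→ℚ k → m ≤ k
ℕ→ℚ-cancel-≤ {m} {k} (*≤* le)
  with +≤+ m≤k ← subst₂ ℤ._≤_ (ℤ.*-identityʳ (ℤ.+ m)) (ℤ.*-identityʳ (ℤ.+ k)) le = m≤k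

Meet : ℕ × ℕ → ℕ × ℕ → Set
Meet (lo₁ , hi₁) (lo₂ , hi₂) = lo₁ ≤ hi₂ × lo₂ ≤ hi₁

boxRepresentation-ℕ : ∀ {m k} {Gr : Graph m} (interval : Fin m → Fin k → ℕ × ℕ) →
  (∀ u i → proj₁ (interval u i) ≤ proj₂ (interval u i)) →
  (∀ u v → u ≢ v → Gr u v ⇔ (∀ i → Meet (interval u i) (interval v i))) →
  BoxRepresentation Gr k
boxRepresentation-ℕ {m} {k} interval nonempty adjacent⇔meet = box , λ u v u≢v →
    (λ uv i → map ℕ→ℚ-mono-≤ ℕ→ℚ-mono-≤ (to (adjacent⇔meet u v u≢v) uv i))
  , (λ I → from (adjacent⇔meet u v u≢v) (λ i → map ℕ→ℚ-cancel-≤ ℕ→ℚ-cancel-≤ (I i)))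
  where
  box : Fin m → Box k
  box u = record
    { lo    = ℕ→ℚ ∘ proj₁ ∘ interval u
    ; hi    = ℕ→ℚ ∘ proj₂ ∘ interval u
    ; lo≤hi = ℕ→ℚ-mono-≤ ∘ nonempty u
    }

clique-size≤colours : ∀ {m k c} {Gr : Graph m} (f : Fin k → Fin m) →
  (∀ {i j} → i ≢ j → Gr (f i) (f j)) → ProperColouring Gr c → k ≤ c
clique-size≤colours f clique (colour , proper) = ≮⇒≥ λ c<k →
  let i , j , i<j , same-colour = pigeonhole c<k (colour ∘ f)
  in proper (f i) (f j) (clique (Finₚ.<⇒≢ i<j)) same-colour

-- For x, y < a, Far a b x y says that x and y are at cyclic distance at least b in ℤ/a.
Ahead : (a b x y : ℕ) → Set
Ahead a b x y = y + b ≤ x × x + b ≤ y + a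

Far : (a b x y : ℕ) → Set
Far a b x y = Ahead a b x y ⊎ Ahead a b y x

ahead⇔offset : ∀ {a b x y} → b ≤ a →
  Ahead a b x y ⇔ (∃ λ j → b ≤ j × j ≤ a ∸ b × y + j ≡ x)
ahead⇔offset {a} {b} {x} {y} b≤a = mk⇔ offset ahead
  where
  offset : Ahead a b x y → ∃ λ j → b ≤ j × j ≤ a ∸ b × y + j ≡ x
  offset (y+b≤x , x+b≤y+a) =
    x ∸ y , m+n≤o⇒m≤o∸n b (subst (_≤ x) (+-comm y b) y+b≤x) , j≤a∸b , m+[n∸m]≡n y≤x
    where
    y≤x : y ≤ x
    y≤x = m+n≤o⇒m≤o y y+b≤x
    j≤a∸b : x ∸ y ≤ a ∸ b
    j≤a∸b = m+n≤o⇒m≤o∸n (x ∸ y)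
      (subst (_≤ a) (+-∸-comm b y≤x) (m≤n+o⇒m∸n≤o (x + b) y x+b≤y+a))
  ahead : (∃ λ j → b ≤ j × j ≤ a ∸ b × y + j ≡ x) → Ahead a b x y
  ahead (j , b≤j , j≤a∸b , refl) =
    +-monoʳ-≤ y b≤j ,
    subst (_≤ y + a) (sym (+-assoc y j b)) (+-monoʳ-≤ y (m≤o∸n⇒m+n≤o j b≤a j≤a∸b))

ahead-wrap : ∀ {a b x y} → Ahead a b (x + a) y ⇔ Ahead a b y x
ahead-wrap {a} {b} {x} {y} = mk⇔
  (λ (y+b≤x+a , x+a+b≤y+a) →
    +-cancelʳ-≤ a (x + b) y (subst (_≤ y + a) (xy∙z≈xz∙y x a b) x+a+b≤y+a) , y+b≤x+a)
  (λ (x+b≤y , y+b≤x+a) →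
    y+b≤x+a , subst (_≤ y + a) (sym (xy∙z≈xz∙y x a b)) (+-monoˡ-≤ a x+b≤y))

ahead⇒≢ : ∀ {a b x y} → 1 ≤ b → Ahead a b x y → x ≢ y
ahead⇒≢ {y = y} 1≤b (y+b≤x , _) refl = <-irrefl refl (<-≤-trans (m<m+n y 1≤b) y+b≤x)

circulant-adjacent⇔far : ∀ {a b} → 1 ≤ b → b ≤ a → (u v : Fin a) →
  G a b u v ⇔ Far a b (toℕ u) (toℕ v)
circulant-adjacent⇔far {a} {b} 1≤b b≤a u v = mk⇔ far adjacent
  where
  x = toℕ u
  y = toℕ v
  far : G a b u v → Far a b x y
  far (_ , j , b≤j , j≤a∸b , zero , eq) =
    inj₁ (from (ahead⇔offset b≤a) (j , b≤j , j≤a∸b , trans eq (+-identityʳ x)))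
  far (_ , j , b≤j , j≤a∸b , suc zero , eq) =
    inj₂ (to ahead-wrap (from (ahead⇔offset b≤a) (j , b≤j , j≤a∸b , trans eq (cong (x +_) (+-identityʳ a)))))
  far (_ , j , _ , j≤a∸b , suc (suc q) , eq) = ⊥-elim (<-irrefl eq y+j<x+2a)
    where
    y+j<x+2a : y + j < x + (a + (a + q * a))
    y+j<x+2a = <-≤-trans (+-mono-<-≤ (toℕ<n v) (≤-trans j≤a∸b (m∸n≤m a b)))
      (≤-trans (+-monoʳ-≤ a (m≤m+n a (q * a))) (m≤n+m _ x))
  adjacent : Far a b x y → G a b u v
  adjacent (inj₁ ahead) with j , b≤j , j≤a∸b , eq ← to (ahead⇔offset b≤a) ahead =
    ahead⇒≢ 1≤b ahead ∘ cong toℕ , j , b≤j , j≤a∸b , 0 , trans eq (sym (+-identityʳ x))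
  adjacent (inj₂ behind) with j , b≤j , j≤a∸b , eq ← to (ahead⇔offset b≤a) (from ahead-wrap behind) =
    ahead⇒≢ 1≤b behind ∘ sym ∘ cong toℕ , j , b≤j , j≤a∸b , 1 , trans eq (cong (x +_) (sym (+-identityʳ a)))

Lex : ℕ × ℕ → ℕ × ℕ → Set
Lex = ×-Lex _≡_ _<_ _≤_

lex⇒≤₁ : ∀ {a x c y} → Lex (a , x) (c , y) → a ≤ c
lex⇒≤₁ (inj₁ a<c)       = <⇒≤ a<c
lex⇒≤₁ (inj₂ (refl , _)) = ≤-refl

lex-≡₁⇒≤₂ : ∀ {a x c y} → Lex (a , x) (c , y) → a ≡ c → x ≤ y
lex-≡₁⇒≤₂ (inj₁ a<c)       a≡c = ⊥-elim (<-irrefl a≡c a<c)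
lex-≡₁⇒≤₂ (inj₂ (_ , x≤y)) _   = x≤y

mixed-radix-< : ∀ {b s t p r} → p < b → s < t → b * s + p < b * t + r
mixed-radix-< {b} {s} {t} {p} {r} p<b s<t = begin-strict
  b * s + p  <⟨ +-monoʳ-< (b * s) p<b ⟩
  b * s + b  ≡⟨ +-comm (b * s) b ⟩
  b + b * s  ≡⟨ *-suc b s ⟨
  b * suc s  ≤⟨ *-monoʳ-≤ b s<t ⟩
  b * t      ≤⟨ m≤m+n (b * t) r ⟩
  b * t + r  ∎
  where open ≤-Reasoning

mixed-radix-≤⇔lex : ∀ {b s t p r} → p < b → r < b → b * s + p ≤ b * t + r ⇔ Lex (s , p) (t , r)
mixed-radix-≤⇔lex {b} {s} {t} {p} {r} p<b r<b = mk⇔ lex ≤-of-lex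
  where
  lex : b * s + p ≤ b * t + r → Lex (s , p) (t , r)
  lex le with <-cmp s t
  ... | tri< s<t _ _ = inj₁ s<t
  ... | tri≈ _ refl _ = inj₂ (refl , +-cancelˡ-≤ (b * s) p r le)
  ... | tri> _ _ t<s = ⊥-elim (<⇒≱ (mixed-radix-< r<b t<s) le)
  ≤-of-lex : Lex (s , p) (t , r) → b * s + p ≤ b * t + r
  ≤-of-lex (inj₁ s<t) = <⇒≤ (mixed-radix-< p<b s<t)
  ≤-of-lex (inj₂ (refl , p≤r)) = +-monoʳ-≤ (b * s) p≤r

module Blocks (n b : ℕ) where

  -- For s, t < n this says t ≡ s + 1 (mod n).
  infix 4 _↝_
  _↝_ : ℕ → ℕ → Set
  s ↝ t = suc s ≡ t ⊎ suc s ≡ t + n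

  record Separated (s p t r : ℕ) : Set where
    field
      distinct     : s ≢ t
      next-ordered : s ↝ t → p ≤ r
      prev-ordered : t ↝ s → r ≤ p
  open Separated

  separated-sym : ∀ {s p t r} → Separated s p t r → Separated t r s p
  separated-sym sep = record
    { distinct     = distinct sep ∘ sym
    ; next-ordered = prev-ordered sep
    ; prev-ordered = next-ordered sep
    }

  ahead⇔lex : ∀ {s p t r} → p < b → r < b →
    Ahead (n * b) b (b * s + p) (b * t + r) ⇔ (Lex (suc t , r) (s , p) × Lex (suc s , p) (t + n , r))
  ahead⇔lex {s} {p} {t} {r} p<b r<b = mk⇔
    (λ (below , above) →
        to (mixed-radix-≤⇔lex r<b p<b) (subst (_≤ b * s + p) (step b t r) below)
      , to (mixed-radix-≤⇔lex p<b r<b) (subst₂ _≤_ (step b s p) (wrap n b t r) above))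
    (λ (below , above) →
        subst (_≤ b * s + p) (sym (step b t r)) (from (mixed-radix-≤⇔lex r<b p<b) below)
      , subst₂ _≤_ (sym (step b s p)) (sym (wrap n b t r)) (from (mixed-radix-≤⇔lex p<b r<b) above))
    where
    step : ∀ c k q → c * k + q + c ≡ c * suc k + q
    step = solve-∀
    wrap : ∀ m c k q → c * k + q + m * c ≡ c * (k + m) + q
    wrap = solve-∀

  separated-of-lex : ∀ {s p t r} → t < n →
    Lex (suc t , r) (s , p) → Lex (suc s , p) (t + n , r) → Separated s p t r
  separated-of-lex {s} {p} {t} {r} t<n below above = record
    { distinct     = λ s≡t → <-irrefl (sym s≡t) t<s
    ; next-ordered = next-ordered′
    ; prev-ordered = prev-ordered′
    }
    where
    t<s : t < s
    t<s = lex⇒≤₁ below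
    next-ordered′ : s ↝ t → p ≤ r
    next-ordered′ (inj₁ 1+s≡t)   = ⊥-elim (<-asym t<s (subst (s <_) 1+s≡t (n<1+n s)))
    next-ordered′ (inj₂ 1+s≡t+n) = lex-≡₁⇒≤₂ above 1+s≡t+n
    prev-ordered′ : t ↝ s → r ≤ p
    prev-ordered′ (inj₁ 1+t≡s)   = lex-≡₁⇒≤₂ below 1+t≡s
    prev-ordered′ (inj₂ 1+t≡s+n) =
      ⊥-elim (<-irrefl 1+t≡s+n (≤-<-trans t<n (m<n+m n (≤-trans (s≤s z≤n) t<s))))

  lex-of-separated : ∀ {s p t r} → s < n → t < s → Separated s p t r →
    Lex (suc t , r) (s , p) × Lex (suc s , p) (t + n , r)
  lex-of-separated {s} {p} {t} {r} s<n t<s sep = below , above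
    where
    below : Lex (suc t , r) (s , p)
    below with suc t ≟ s
    ... | yes 1+t≡s = inj₂ (1+t≡s , prev-ordered sep (inj₁ 1+t≡s))
    ... | no 1+t≢s  = inj₁ (≤∧≢⇒< t<s 1+t≢s)
    above : Lex (suc s , p) (t + n , r)
    above with suc s ≟ t + n
    ... | yes 1+s≡t+n = inj₂ (1+s≡t+n , next-ordered sep (inj₂ 1+s≡t+n))
    ... | no 1+s≢t+n  = inj₁ (≤∧≢⇒< (≤-trans s<n (m≤n+m n t)) 1+s≢t+n)

  far⇔separated : ∀ {s p t r} → s < n → t < n → p < b → r < b →
    Far (n * b) b (b * s + p) (b * t + r) ⇔ Separated s p t r
  far⇔separated {s} {p} {t} {r} s<n t<n p<b r<b = mk⇔ separated far
    where
    separated : Far (n * b) b (b * s + p) (b * t + r) → Separated s p t r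
    separated (inj₁ ahead)  = uncurry (separated-of-lex t<n) (to (ahead⇔lex p<b r<b) ahead)
    separated (inj₂ behind) = separated-sym (uncurry (separated-of-lex s<n) (to (ahead⇔lex r<b p<b) behind))
    far : Separated s p t r → Far (n * b) b (b * s + p) (b * t + r)
    far sep with <-cmp s t
    ... | tri< s<t _ _  = inj₂ (from (ahead⇔lex r<b p<b) (lex-of-separated t<n s<t (separated-sym sep)))
    ... | tri≈ _ s≡t _  = ⊥-elim (distinct sep s≡t)
    ... | tri> _ _ t<s = inj₁ (from (ahead⇔lex p<b r<b) (lex-of-separated s<n t<s sep))

  data Role (m s : ℕ) : Set where
    home  : s ≡ m → Role m s
    next  : s ≢ m → m ↝ s → Role m s
    other : s ≢ m → ¬ m ↝ s → Role m s

  role : ∀ m s → Role m s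
  role m s with s ≟ m | (suc m ≟ s) ⊎-dec (suc m ≟ s + n)
  ... | yes s≡m | _        = home s≡m
  ... | no s≢m  | yes m↝s = next s≢m m↝s
  ... | no s≢m  | no ¬m↝s = other s≢m ¬m↝s

  interval : ∀ {m s} → Role m s → ℕ → ℕ × ℕ
  interval (home _)    p = p , p
  interval (next _ _)  p = 0 , p
  interval (other _ _) p = 0 , b

  interval-nonempty : ∀ {m s} (ρ : Role m s) p → proj₁ (interval ρ p) ≤ proj₂ (interval ρ p)
  interval-nonempty (home _)    _ = ≤-refl
  interval-nonempty (next _ _)  _ = z≤n
  interval-nonempty (other _ _) _ = z≤n

  MeetAt : (m s p t r : ℕ) → Set
  MeetAt m s p t r = Meet (interval (role m s) p) (interval (role m t) r)

  meet-of-separated : ∀ {s p t r} → p < b → r < b → Separated s p t r → ∀ m → MeetAt m s p t r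
  meet-of-separated {s} {p} {t} {r} p<b r<b sep m with role m s | role m t
  ... | home s≡m   | home t≡m   = ⊥-elim (distinct sep (trans s≡m (sym t≡m)))
  ... | home refl  | next _ s↝t = next-ordered sep s↝t , z≤n
  ... | home _     | other _ _  = <⇒≤ p<b , z≤n
  ... | next _ t↝s | home refl  = z≤n , prev-ordered sep t↝s
  ... | other _ _  | home _     = z≤n , <⇒≤ r<b
  ... | next _ _   | next _ _   = z≤n , z≤n
  ... | next _ _   | other _ _  = z≤n , z≤n
  ... | other _ _  | next _ _   = z≤n , z≤n
  ... | other _ _  | other _ _  = z≤n , z≤n

  meet-at-home : ∀ {s p t r} → MeetAt s s p t r → s ≡ t ⊎ s ↝ t → p ≤ r
  meet-at-home {s} {p} {t} {r} meet with role s s | role s t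
  ... | home _      | home _         = λ _ → proj₁ meet
  ... | home _      | next _ _       = λ _ → proj₁ meet
  ... | home _      | other t≢s ¬s↝t = λ where
                                          (inj₁ s≡t) → ⊥-elim (t≢s (sym s≡t))
                                          (inj₂ s↝t) → ⊥-elim (¬s↝t s↝t)
  ... | next s≢s _  | _              = ⊥-elim (s≢s refl)
  ... | other s≢s _ | _              = ⊥-elim (s≢s refl)

  separated-of-meet : ∀ {s p t r} → MeetAt s s p t r → MeetAt t s p t r → (s ≡ t → p ≢ r) →
    Separated s p t r
  separated-of-meet meetₛ meetₜ same-block⇒p≢r = record
    { distinct     = λ s≡t → same-block⇒p≢r s≡t
                       (≤-antisym (meet-at-home meetₛ (inj₁ s≡t)) (meet-at-home (swap meetₜ) (inj₁ (sym s≡t))))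
    ; next-ordered = meet-at-home meetₛ ∘ inj₂
    ; prev-ordered = meet-at-home (swap meetₜ) ∘ inj₂
    }

  block offset : Fin (n * b) → ℕ
  block u  = toℕ (quotient {n} b u)
  offset u = toℕ (remainder {n} b u)

  toℕ≡block-offset : ∀ u → toℕ u ≡ b * block u + offset u
  toℕ≡block-offset u =
    trans (cong toℕ (sym (combine-remQuot {n} b u))) (toℕ-combine (quotient {n} b u) (remainder {n} b u))

  module _ .{{_ : NonZero n}} .{{_ : NonZero b}} where

    adjacent⇔separated : ∀ u v → G (n * b) b u v ⇔ Separated (block u) (offset u) (block v) (offset v)
    adjacent⇔separated u v =
      subst₂ (λ x y → Far (n * b) b x y ⇔ Separated (block u) (offset u) (block v) (offset v))
        (sym (toℕ≡block-offset u)) (sym (toℕ≡block-offset v))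
        (far⇔separated (toℕ<n _) (toℕ<n _) (toℕ<n _) (toℕ<n _))
      ⇔-∘ circulant-adjacent⇔far (>-nonZero⁻¹ b) (m≤n*m b n) u v

    vertexInterval : Fin (n * b) → Fin n → ℕ × ℕ
    vertexInterval u i = interval (role (toℕ i) (block u)) (offset u)

    meets⇔separated : ∀ {u v} → u ≢ v →
      (∀ i → Meet (vertexInterval u i) (vertexInterval v i)) ⇔ Separated (block u) (offset u) (block v) (offset v)
    meets⇔separated {u} {v} u≢v = mk⇔
      (λ meet → separated-of-meet (meet (quotient {n} b u)) (meet (quotient {n} b v)) same-block⇒offsets-differ)
      (λ sep i → meet-of-separated (toℕ<n _) (toℕ<n _) sep (toℕ i))
      where
      same-block⇒offsets-differ : block u ≡ block v → offset u ≢ offset v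
      same-block⇒offsets-differ s≡t p≡r = u≢v (toℕ-injective (begin
        toℕ u                  ≡⟨ toℕ≡block-offset u ⟩
        b * block u + offset u ≡⟨ cong₂ (λ s p → b * s + p) s≡t p≡r ⟩
        b * block v + offset v ≡⟨ toℕ≡block-offset v ⟨
        toℕ v                  ∎))
        where open ≡-Reasoning

    boxRepresentation : BoxRepresentation (G (n * b) b) n
    boxRepresentation = boxRepresentation-ℕ vertexInterval
      (λ u i → interval-nonempty (role (toℕ i) (block u)) (offset u))
      (λ u v u≢v → ⇔-sym (meets⇔separated u≢v) ⇔-∘ adjacent⇔separated u v)

    combine-adjacent : (p : Fin b) {i j : Fin n} → i ≢ j → G (n * b) b (combine i p) (combine j p)
    combine-adjacent p {i} {j} i≢j =
      from (adjacent⇔separated (combine i p) (combine j p))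
        (subst₂ (λ (s , q) (t , r) → Separated (toℕ s) (toℕ q) (toℕ t) (toℕ r))
          (sym (remQuot-combine i p)) (sym (remQuot-combine j p)) separated)
      where
      separated : Separated (toℕ i) (toℕ p) (toℕ j) (toℕ p)
      separated = record
        { distinct     = i≢j ∘ toℕ-injective
        ; next-ordered = λ _ → ≤-refl
        ; prev-ordered = λ _ → ≤-refl
        }

theorem4p1 : ∀ (n b : ℕ) → 2 ≤ n → 1 ≤ b → ∀ (c : ℕ) →
    IsChromaticNumber (G (n * b) b) c → BoxicityAtMost (G (n * b) b) c
theorem4p1 n b (s≤s (s≤s _)) (s≤s _) c (colouring , _) =
    n
  , clique-size≤colours (λ i → combine i Fin.zero) (combine-adjacent Fin.zero) colouring
  , boxRepresentation
  where open Blocks n b
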